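{- Let $P$ be a perfect coloring into $k$ colors of a $d$-uniform hypergraph $\mathcal{G}$ with parameter matrix $\mathbb{S}$, and let $\lambda$ be an eigenvalue of $\mathbb{S}$. Then there is an eigenvector $y$ of (the adjacency matrix of) $\mathcal{G}$ for the eigenvalue $\lambda$ whose components take at most $k$ distinct values.
   Context: A $d$-uniform hypergraph on vertex set $[n]$ has $d$-element hyperedges. Its adjacency matrix $\mathbb{A}$ is the $d$-dimensional array with $a_{(x_1,\dots,x_d)}=1/(d-1)!$ if $\{x_1,\dots,x_d\}$ is a hyperedge, and $0$ otherwise. A coloring is a surjective map $f:[n]\to[k]$ with color matrix $P$ ($p_{x,i}=1$ iff $f(x)=i$). We use $$(\mathbb{A}\circ P)_{x,j_1,\dots,j_{d-1}}=\sum_{x_1,\dots,x_{d-1}}a_{x,x_1,\dots,x_{d-1}}p_{x_1,j_1}\cdots p_{x_{d-1},j_{d-1}},\qquad (P\circ\mathbb{S})_{x,\beta}=\sum_ip_{x,i}s_{i,\beta}.$$ The coloring is perfect if there is a $d$-dimensional $\mathbb{S}$ of order $k$ with $\mathbb{A}\circ P=P\circ\mathbb{S}$ (equivalently, all vertices of the same color lie in equally many hyperedges of each color range); $\mathbb{S}$ is the parameter matrix. For a $d$-dimensional matrix $\mathbb{M}$ of order $m$, $\lambda\in\mathbb{C}$ is an eigenvalue with eigenvector $x\in\mathbb{C}^m\setminus\{0\}$ if $\sum_{i_2,\dots,i_d}m_{i,i_2,\dots,i_d}x_{i_2}\cdots x_{i_d}=\lambda x_i^{d-1}$ for all $i$.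 Eigenvalues and eigenvectors of $\mathcal{G}$ are those of $\mathbb{A}$. -}

module Defs where

open import Level using (Level)
open import Algebra.Bundles using (CommutativeRing)
open import Data.Nat.Base using (ℕ; zero; suc)
open import Data.Bool.Base using (Bool; true; false; if_then_else_; T; _∨_)
open import Data.Fin.Base using (Fin; zero; suc)
open import Data.Fin.Properties using (_≟_)
open import Data.Fin.Subset using (Subset; ∣_∣)
open import Data.Vec.Base using (tabulate)
open import Data.Vec.Functional using (_∷_)
open import Data.Product using (Σ; ∃; _×_)
open import Relation.Nullary using (¬_)
open import Relation.Nullary.Decidable using (⌊_⌋)
open import Relation.Binary.PropositionalEquality using (_≡_)

record Hypergraph (n d : ℕ) : Set where
  field
    isEdge  : Subset n → Bool
    uniform : ∀ (s : Subset n) → T (isEdge s) → ∣ s ∣ ≡ d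

anyFin : ∀ {m} → (Fin m → Bool) → Bool
anyFin {zero}  b = false
anyFin {suc m} b = b zero ∨ anyFin (λ i → b (suc i))

image : ∀ {n d} → (Fin d → Fin n) → Subset n
image t = tabulate (λ y → anyFin (λ i → ⌊ t i ≟ y ⌋))

-- Algebra over a commutative ring R (the paper works over ℂ).

module _ {a ℓ : Level} (R : CommutativeRing a ℓ) where
  open CommutativeRing R using (Carrier; _≈_; _+_; _*_; 0#; 1#)

  sumF : ∀ {n} → (Fin n → Carrier) → Carrier
  sumF {zero}  f = 0#
  sumF {suc n} f = f zero + sumF (λ i → f (suc i))

  prodF : ∀ {n} → (Fin n → Carrier) → Carrier
  prodF {zero}  f = 1#
  prodF {suc n} f = f zero * prodF (λ i → f (suc i))

  sumT : ∀ {n} (m : ℕ) → ((Fin m → Fin n) → Carrier) → Carrier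
  sumT zero    f = f (λ ())
  sumT (suc m) f = sumF (λ i → sumT m (λ t → f (i ∷ t)))

  pow : Carrier → ℕ → Carrier
  pow x m = prodF {m} (λ _ → x)

  fromℕ : ℕ → Carrier
  fromℕ zero    = 0#
  fromℕ (suc n) = 1# + fromℕ n

  -- A (suc m)-dimensional matrix of order o: entry M i (i_2,...,i_{m+1}).
  Tensor : (m o : ℕ) → Set a
  Tensor m o = Fin o → (Fin m → Fin o) → Carrier

  IsEigenpair : ∀ {m o} → Tensor m o → Carrier → (Fin o → Carrier) → Set ℓ
  IsEigenpair {m} M λ' x =
    (¬ (∀ i → x i ≈ 0#)) ×
    (∀ i → sumT m (λ t → M i t * prodF (λ j → x (t j))) ≈ λ' * pow (x i) m)

  IsEigenvalue : ∀ {m o} → Tensor m o → Carrier → Set (a Level.⊔ ℓ)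
  IsEigenvalue M λ' = ∃ (λ x → IsEigenpair M λ' x)

  -- adjacency matrix of a d-uniform hypergraph, d = suc m, with
  -- c playing the role of 1/(d-1)!:  a_{x,x_1..x_m} = c if {x,x_1..x_m} ∈ E.
  adj : ∀ {n m} → Hypergraph n (suc m) → Carrier → Tensor m n
  adj G c x t = if Hypergraph.isEdge G (image (x ∷ t)) then c else 0#

  colorMatrix : ∀ {n k} → (Fin n → Fin k) → Fin n → Fin k → Carrier
  colorMatrix f x i = if ⌊ f x ≟ i ⌋ then 1# else 0#

  adjCirc : ∀ {n m k} → Tensor m n → (Fin n → Fin k → Carrier) →
            Fin n → (Fin m → Fin k) → Carrier
  adjCirc {m = m} A P x js = sumT m (λ t → A x t * prodF (λ l → P (t l) (js l)))

  circParam : ∀ {n m k} → (Fin n → Fin k → Carrier) → Tensor m k →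
              Fin n → (Fin m → Fin k) → Carrier
  circParam P S x β = sumF (λ i → P x i * S i β)

  IsPerfectColoringWith : ∀ {n m k} → Hypergraph n (suc m) → Carrier →
                          (Fin n → Fin k) → Tensor m k → Set ℓ
  IsPerfectColoringWith G c f S =
    ∀ x β → adjCirc (adj G c) (colorMatrix f) x β ≈ circParam (colorMatrix f) S x β

module Submission where

-- Let z be an eigenvector of S for μ and y = z ∘ f, which is constant on colour classes.
-- Since y = P z for the colour matrix P, the identity A ∘ P = P ∘ S gives
-- A y^(d-1) = (A ∘ P) z^(d-1) = (P ∘ S) z^(d-1) = P (S z^(d-1)) = P (μ z^(d-1)) = μ y^(d-1),
-- and y ≠ 0 because f is surjective.

open import Defs
open import Algebra.Bundles using (CommutativeRing)
open import Data.Nat.Base using (ℕ; zero; suc; _!)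
open import Data.Fin.Base using (Fin; zero; suc)
open import Data.Fin.Properties using (_≟_)
open import Data.Product using (∃; _×_; _,_)
open import Data.Bool.Base using (if_then_else_)
open import Data.Vec.Functional using (_∷_)
open import Function.Base using (_∘_)
open import Function.Definitions using (Surjective)
open import Relation.Nullary using (¬_)
open import Relation.Nullary.Decidable using (⌊_⌋; ⌊⌋-map′)
open import Relation.Binary.PropositionalEquality using (_≡_)
import Relation.Binary.PropositionalEquality as ≡
import Algebra.Properties.Semiring.Sum as SemiringSum
import Algebra.Properties.CommutativeMonoid.Sum as CommutativeMonoidSum
import Relation.Binary.Reasoning.Setoid as SetoidReasoning

module TensorAlgebra {a ℓ} (R : CommutativeRing a ℓ) where
  open CommutativeRing R hiding (zero)
  open SetoidReasoning setoid

  open SemiringSum semiring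
    using (sum; sum-cong-≋; sum-replicate-zero; *-distribˡ-sum; *-distribʳ-sum; ∑-comm)
  open CommutativeMonoidSum *-commutativeMonoid
    using () renaming (sum to prod; sum-cong-≋ to prod-cong-≋; ∑-distrib-+ to prod-distrib-*)

  -- sumF and prodF are only propositionally the library's sums over (R, +) and (R, *),
  -- so the library lemmas are transported along sumF≡sum and prodF≡prod.
  sumF≡sum : ∀ {n} (f : Fin n → Carrier) → sumF R f ≡ sum f
  sumF≡sum {zero}  f = ≡.refl
  sumF≡sum {suc n} f = ≡.cong (f zero +_) (sumF≡sum (f ∘ suc))

  prodF≡prod : ∀ {n} (f : Fin n → Carrier) → prodF R f ≡ prod f
  prodF≡prod {zero}  f = ≡.refl
  prodF≡prod {suc n} f = ≡.cong (f zero *_) (prodF≡prod (f ∘ suc))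

  sumF-cong : ∀ {n} {f g : Fin n → Carrier} → (∀ i → f i ≈ g i) → sumF R f ≈ sumF R g
  sumF-cong {f = f} {g} f≈g rewrite sumF≡sum f | sumF≡sum g = sum-cong-≋ f≈g

  sumF-zero : ∀ n → sumF R {n} (λ _ → 0#) ≈ 0#
  sumF-zero n rewrite sumF≡sum {n} (λ _ → 0#) = sum-replicate-zero n

  *-distribˡ-sumF : ∀ {n} c (f : Fin n → Carrier) → c * sumF R f ≈ sumF R (λ i → c * f i)
  *-distribˡ-sumF c f rewrite sumF≡sum f | sumF≡sum (λ i → c * f i) = *-distribˡ-sum c f

  *-distribʳ-sumF : ∀ {n} c (f : Fin n → Carrier) → sumF R f * c ≈ sumF R (λ i → f i * c)
  *-distribʳ-sumF c f rewrite sumF≡sum f | sumF≡sum (λ i → f i * c) = *-distribʳ-sum c f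

  sumF-comm : ∀ {p q} (h : Fin p → Fin q → Carrier) →
              sumF R (λ i → sumF R (h i)) ≈ sumF R (λ j → sumF R (λ i → h i j))
  sumF-comm {p} {q} h = begin
    sumF R (λ i → sumF R (h i))
      ≈⟨ sumF-cong {p} (λ i → reflexive (sumF≡sum (h i))) ⟩
    sumF R (λ i → sum (h i))
      ≡⟨ sumF≡sum (λ i → sum (h i)) ⟩
    sum (λ i → sum (h i))
      ≈⟨ ∑-comm h ⟩
    sum (λ j → sum (λ i → h i j))
      ≡⟨ ≡.sym (sumF≡sum (λ j → sum (λ i → h i j))) ⟩
    sumF R (λ j → sum (λ i → h i j))
      ≈⟨ sumF-cong {q} (λ j → reflexive (≡.sym (sumF≡sum (λ i → h i j)))) ⟩
    sumF R (λ j → sumF R (λ i → h i j)) ∎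

  prodF-cong : ∀ {n} {f g : Fin n → Carrier} → (∀ i → f i ≈ g i) → prodF R f ≈ prodF R g
  prodF-cong {f = f} {g} f≈g rewrite prodF≡prod f | prodF≡prod g = prod-cong-≋ f≈g

  prodF-distrib-* : ∀ {n} (f g : Fin n → Carrier) →
                    prodF R (λ i → f i * g i) ≈ prodF R f * prodF R g
  prodF-distrib-* f g
    rewrite prodF≡prod (λ i → f i * g i) | prodF≡prod f | prodF≡prod g = prod-distrib-* f g

  sumT-cong : ∀ {n} m {f g : (Fin m → Fin n) → Carrier} →
              (∀ t → f t ≈ g t) → sumT R m f ≈ sumT R m g
  sumT-cong zero    f≈g = f≈g _
  sumT-cong {n} (suc m) f≈g = sumF-cong {n} (λ i → sumT-cong m (λ t → f≈g (i ∷ t)))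

  *-distribˡ-sumT : ∀ {n} m c (f : (Fin m → Fin n) → Carrier) →
                    c * sumT R m f ≈ sumT R m (λ t → c * f t)
  *-distribˡ-sumT zero    c f = refl
  *-distribˡ-sumT {n} (suc m) c f = trans (*-distribˡ-sumF {n} c _)
    (sumF-cong {n} (λ i → *-distribˡ-sumT m c (λ t → f (i ∷ t))))

  *-distribʳ-sumT : ∀ {n} m c (f : (Fin m → Fin n) → Carrier) →
                    sumT R m f * c ≈ sumT R m (λ t → f t * c)
  *-distribʳ-sumT zero    c f = refl
  *-distribʳ-sumT {n} (suc m) c f = trans (*-distribʳ-sumF {n} c _)
    (sumF-cong {n} (λ i → *-distribʳ-sumT m c (λ t → f (i ∷ t))))

  sumF-sumT-comm : ∀ {p n} m (h : Fin p → (Fin m → Fin n) → Carrier) →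
                   sumF R (λ i → sumT R m (h i)) ≈ sumT R m (λ t → sumF R (λ i → h i t))
  sumF-sumT-comm zero    h = refl
  sumF-sumT-comm {p} {n} (suc m) h = trans (sumF-comm {p} {n} _)
    (sumF-cong {n} (λ j → sumF-sumT-comm m (λ i t → h i (j ∷ t))))

  sumT-comm : ∀ {n n'} m m' (h : (Fin m → Fin n) → (Fin m' → Fin n') → Carrier) →
              sumT R m (λ t → sumT R m' (h t)) ≈ sumT R m' (λ s → sumT R m (λ t → h t s))
  sumT-comm zero    m' h = refl
  sumT-comm {n} (suc m) m' h =
    trans (sumF-cong {n} (λ i → sumT-comm m m' (λ t → h (i ∷ t)))) (sumF-sumT-comm {n} m' _)

  prodF-sumF-distrib : ∀ {n} m (g : Fin m → Fin n → Carrier) →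
    prodF R (λ l → sumF R (g l)) ≈ sumT R m (λ js → prodF R (λ l → g l (js l)))
  prodF-sumF-distrib zero    g = refl
  prodF-sumF-distrib (suc m) g = begin
    sumF R (g zero) * prodF R (λ l → sumF R (g (suc l)))
      ≈⟨ *-congˡ (prodF-sumF-distrib m (g ∘ suc)) ⟩
    sumF R (g zero) * sumT R m (λ js → prodF R (λ l → g (suc l) (js l)))
      ≈⟨ *-distribʳ-sumF _ (g zero) ⟩
    sumF R (λ i → g zero i * sumT R m (λ js → prodF R (λ l → g (suc l) (js l))))
      ≈⟨ sumF-cong (λ i → *-distribˡ-sumT m (g zero i) _) ⟩
    sumT R (suc m) (λ js → prodF R (λ l → g l (js l))) ∎

  sumF-select : ∀ {k} (b : Fin k) (h : Fin k → Carrier) →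
                sumF R (λ i → (if ⌊ b ≟ i ⌋ then 1# else 0#) * h i) ≈ h b
  sumF-select {suc k} zero h = begin
    1# * h zero + sumF R (λ i → 0# * h (suc i))
      ≈⟨ +-cong (*-identityˡ _) (sumF-cong (λ i → zeroˡ (h (suc i)))) ⟩
    h zero + sumF R {k} (λ _ → 0#)
      ≈⟨ +-congˡ (sumF-zero k) ⟩
    h zero + 0#
      ≈⟨ +-identityʳ _ ⟩
    h zero ∎
  sumF-select {suc k} (suc b) h = begin
    0# * h zero + sumF R (λ i → (if ⌊ suc b ≟ suc i ⌋ then 1# else 0#) * h (suc i))
      ≈⟨ +-cong (zeroˡ _) (sumF-cong (λ i → *-congʳ (reflexive (≡.cong
           (λ t → if t then 1# else 0#) (⌊⌋-map′ _ _ (b ≟ i)))))) ⟩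
    0# + sumF R (λ i → (if ⌊ b ≟ i ⌋ then 1# else 0#) * h (suc i))
      ≈⟨ +-identityˡ _ ⟩
    sumF R (λ i → (if ⌊ b ≟ i ⌋ then 1# else 0#) * h (suc i))
      ≈⟨ sumF-select b (h ∘ suc) ⟩
    h (suc b) ∎

  contract : ∀ {m o} → Tensor R m o → (Fin o → Carrier) → Fin o → Carrier
  contract {m} M x i = sumT R m (λ t → M i t * prodF R (λ j → x (t j)))

  matVec : ∀ {n k} → (Fin n → Fin k → Carrier) → (Fin k → Carrier) → Fin n → Carrier
  matVec P z x = sumF R (λ i → P x i * z i)

  matVec-colorMatrix : ∀ {n k} (f : Fin n → Fin k) (z : Fin k → Carrier) x →
                       matVec (colorMatrix R f) z x ≈ z (f x)
  matVec-colorMatrix f z x = sumF-select (f x) z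

  contract-cong : ∀ {m o} (M : Tensor R m o) {x y : Fin o → Carrier} →
                  (∀ j → x j ≈ y j) → ∀ i → contract M x i ≈ contract M y i
  contract-cong {m} M x≈y i =
    sumT-cong m (λ t → *-congˡ (prodF-cong (λ j → x≈y (t j))))

  contract-matVec : ∀ {n m k} (A : Tensor R m n) (P : Fin n → Fin k → Carrier)
    (z : Fin k → Carrier) x →
    contract A (matVec P z) x ≈ sumT R m (λ js → adjCirc R A P x js * prodF R (z ∘ js))
  contract-matVec {m = m} A P z x = begin
    sumT R m (λ t → A x t * prodF R (λ l → sumF R (λ j → P (t l) j * z j)))
      ≈⟨ sumT-cong m (λ t → *-congˡ (prodF-sumF-distrib m _)) ⟩
    sumT R m (λ t → A x t * sumT R m (λ js → prodF R (λ l → P (t l) (js l) * z (js l))))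
      ≈⟨ sumT-cong m (λ t → *-congˡ (sumT-cong m (λ js → prodF-distrib-* {m} _ _))) ⟩
    sumT R m (λ t → A x t * sumT R m (λ js → Pt t js * prodF R (z ∘ js)))
      ≈⟨ sumT-cong m (λ t → *-distribˡ-sumT m (A x t) _) ⟩
    sumT R m (λ t → sumT R m (λ js → A x t * (Pt t js * prodF R (z ∘ js))))
      ≈⟨ sumT-comm m m _ ⟩
    sumT R m (λ js → sumT R m (λ t → A x t * (Pt t js * prodF R (z ∘ js))))
      ≈⟨ sumT-cong m (λ js → sumT-cong m (λ t → sym (*-assoc _ _ _))) ⟩
    sumT R m (λ js → sumT R m (λ t → A x t * Pt t js * prodF R (z ∘ js)))
      ≈⟨ sumT-cong m (λ js → sym (*-distribʳ-sumT m _ _)) ⟩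
    sumT R m (λ js → adjCirc R A P x js * prodF R (z ∘ js)) ∎
    where
    Pt : (Fin m → Fin _) → (Fin m → Fin _) → Carrier
    Pt t js = prodF R (λ l → P (t l) (js l))

  circParam-contract : ∀ {n m k} (P : Fin n → Fin k → Carrier) (S : Tensor R m k)
    (z : Fin k → Carrier) x →
    sumT R m (λ js → circParam R P S x js * prodF R (z ∘ js)) ≈ matVec P (contract S z) x
  circParam-contract {m = m} {k} P S z x = begin
    sumT R m (λ js → sumF R (λ i → P x i * S i js) * prodF R (z ∘ js))
      ≈⟨ sumT-cong m (λ js → *-distribʳ-sumF {k} _ _) ⟩
    sumT R m (λ js → sumF R (λ i → P x i * S i js * prodF R (z ∘ js)))
      ≈⟨ sumT-cong m (λ js → sumF-cong {k} (λ i → *-assoc _ _ _)) ⟩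
    sumT R m (λ js → sumF R (λ i → P x i * (S i js * prodF R (z ∘ js))))
      ≈⟨ sym (sumF-sumT-comm {k} m _) ⟩
    sumF R (λ i → sumT R m (λ js → P x i * (S i js * prodF R (z ∘ js))))
      ≈⟨ sumF-cong {k} (λ i → sym (*-distribˡ-sumT m (P x i) _)) ⟩
    matVec P (contract S z) x ∎

  contract-intertwine : ∀ {n m k} (A : Tensor R m n) (P : Fin n → Fin k → Carrier)
    (S : Tensor R m k) → (∀ x β → adjCirc R A P x β ≈ circParam R P S x β) →
    ∀ z x → contract A (matVec P z) x ≈ matVec P (contract S z) x
  contract-intertwine {m = m} A P S A∘P≈P∘S z x = begin
    contract A (matVec P z) x
      ≈⟨ contract-matVec A P z x ⟩
    sumT R m (λ js → adjCirc R A P x js * prodF R (z ∘ js))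
      ≈⟨ sumT-cong m (λ js → *-congʳ (A∘P≈P∘S x js)) ⟩
    sumT R m (λ js → circParam R P S x js * prodF R (z ∘ js))
      ≈⟨ circParam-contract P S z x ⟩
    matVec P (contract S z) x ∎

  nonzero-∘-surjective : ∀ {n k} {f : Fin n → Fin k} → Surjective _≡_ _≡_ f →
    (z : Fin k → Carrier) → ¬ (∀ i → z i ≈ 0#) → ¬ (∀ x → z (f x) ≈ 0#)
  nonzero-∘-surjective surj z z≉0 z∘f≈0 = z≉0 λ i →
    let (x , fx≡i) = surj i in ≡.subst (λ j → z j ≈ 0#) (fx≡i ≡.refl) (z∘f≈0 x)

corollary2 : ∀ {a ℓ} (R : CommutativeRing a ℓ) →
    let open CommutativeRing R in
    (n m k : ℕ) (G : Hypergraph n (suc m)) (c : Carrier) →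
    fromℕ R (m !) * c ≈ 1# →
    (f : Fin n → Fin k) → Surjective _≡_ _≡_ f →
    (S : Tensor R m k) → IsPerfectColoringWith R G c f S →
    (μ : Carrier) → IsEigenvalue R S μ →
    ∃ λ (y : Fin n → Carrier) → IsEigenpair R (adj R G c) μ y ×
    ∃ λ (g : Fin k → Carrier) → ∀ x → ∃ λ (i : Fin k) → y x ≈ g i
corollary2 R n m k G c _ f surj S perfect μ (z , z≉0 , Sz≈μz) =
  z ∘ f , (nonzero-∘-surjective surj z z≉0 , eigen) , z , λ x → f x , refl
  where
  open CommutativeRing R
  open TensorAlgebra R
  open SetoidReasoning setoid
  A : Tensor R m n
  A = adj R G c
  P : Fin n → Fin k → Carrier
  P = colorMatrix R f
  eigen : ∀ x → contract A (z ∘ f) x ≈ μ * pow R (z (f x)) m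
  eigen x = begin
    contract A (z ∘ f) x       ≈⟨ contract-cong A (λ y → sym (matVec-colorMatrix f z y)) x ⟩
    contract A (matVec P z) x  ≈⟨ contract-intertwine A P S perfect z x ⟩
    matVec P (contract S z) x  ≈⟨ matVec-colorMatrix f (contract S z) x ⟩
    contract S z (f x)         ≈⟨ Sz≈μz (f x) ⟩
    μ * pow R (z (f x)) m      ∎
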